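{- Let $(X,\mathcal{B})$ be a $3$-$(v,k,1)$-design and let $\tau$ be a positive integer with $k\ge \tau(\tau-1)+1$. Then $(X,\mathcal{B})$ can be used as a distribution design to produce an RTS with threshold $\tau$; that is, there is a positive integer $\sigma$ such that the union of any $\tau$ distinct blocks contains at least $\sigma$ points and the union of any $\tau-1$ blocks contains at most $\sigma-1$ points.
   Context: A $3$-$(v,k,1)$-design is a set system $(X,\mathcal{B})$ with $|X|=v$, every block of size $k$, and every set of $3$ points of $X$ contained in exactly one block. A distribution design $(X,\mathcal{B})$ can be used to produce an RTS with threshold $\tau$ if there exists a positive integer $\sigma$ such that the union of any $\tau$ distinct blocks contains at least $\sigma$ points and the union of any $\tau-1$ blocks contains at most $\sigma-1$ points. -}

module Defs where

open import Data.Nat using (ℕ; _≤_; _<_; _∸_)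
open import Data.Fin using (Fin)
open import Data.Fin.Subset using (Subset; _⊆_; ∣_∣; ⋃)
open import Data.List using (tabulate)
open import Data.Product using (Σ; _×_)
open import Function using (_∘_)
open import Function.Definitions using (Injective)
open import Relation.Binary.PropositionalEquality using (_≡_)

-- A set system on the point set X = Fin v whose blocks are indexed by Fin b.
-- Blocks are pairwise distinct (B is a *set* of blocks), so B is injective.
record SetSystem (v : ℕ) : Set where
  field
    b      : ℕ
    block  : Fin b → Subset v
    distinctBlocks : Injective _≡_ _≡_ block

open SetSystem public

unionOf : ∀ {v m} (S : SetSystem v) → (Fin m → Fin (b S)) → Subset v
unionOf {m = m} S f = ⋃ (tabulate (block S ∘ f))

Is3Design : (v k : ℕ) → SetSystem v → Set
Is3Design v k S =
  (∀ (i : Fin (b S)) → ∣ block S i ∣ ≡ k) ×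
  (∀ (T : Subset v) → ∣ T ∣ ≡ 3 →
     Σ (Fin (b S)) (λ i → (T ⊆ block S i) × (∀ j → T ⊆ block S j → j ≡ i)))

ProducesRTS : ∀ {v} → SetSystem v → (τ : ℕ) → Set
ProducesRTS S τ =
  Σ ℕ (λ σ → (1 ≤ σ) ×
    ((∀ (f : Fin τ → Fin (b S)) → Injective _≡_ _≡_ f → σ ≤ ∣ unionOf S f ∣) ×
     (∀ (g : Fin (τ ∸ 1) → Fin (b S)) → ∣ unionOf S g ∣ < σ)))

-- Let (X,B) be a 3-(v,k,1)-design and τ ≥ 1 with τ(τ-1) < k.  We take
-- σ = τk - τ(τ-1) and check the two RTS conditions by counting points.
--
--  * Two distinct blocks share at most 2 points: three common points would
--    lie in two different blocks, contradicting λ = 1.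
--  * Upper bound: the union of m sets of size ≤ k has at most mk points
--    (union bound), so τ-1 blocks cover at most (τ-1)k < σ points.
--  * Lower bound (a Bonferroni-type inequality): if m sets have size ≥ k and
--    pairwise intersections of size ≤ c, their union has at least
--    mk - c·C(m,2) points.  Adding the sets one at a time, the new set meets
--    the union of the previous ones in at most (number of them)·c points.
--    With c = 2 and 2·C(τ,2) = τ(τ-1), τ distinct blocks cover ≥ σ points.
module Submission where

open import Defs
open import Data.Nat using (ℕ; zero; suc; _≤_; _<_; _*_; _+_; _∸_; z≤n; s≤s)
open import Data.Nat.Properties
open import Data.Nat.Combinatorics using (_C_; nC1≡n; nCk+nC[k+1]≡[n+1]C[k+1])
open import Data.Fin using (Fin) renaming (zero to fzero; suc to fsuc)
open import Data.Fin.Properties using () renaming (suc-injective to fsuc-injective)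
open import Data.Fin.Subset using (Subset; _⊆_; ∣_∣; ⋃; _∩_; _∪_; ⊥; inside; outside)
open import Data.Fin.Subset.Properties
  using (∣⊥∣≡0; ⊥⊆; out⊆; s⊆s; p∩q⊆p; p∩q⊆q; ∩-distribˡ-∪; ∩-zeroʳ)
open import Data.Vec using ([]; _∷_)
open import Data.List using (tabulate)
open import Data.Product using (Σ; _×_; _,_; proj₁; proj₂)
open import Data.Empty using (⊥-elim)
open import Function using (_∘_)
open import Function.Definitions using (Injective)
open import Relation.Binary.PropositionalEquality
open import Relation.Nullary using (¬_; yes; no)

∣p∪q∣+∣p∩q∣≡∣p∣+∣q∣ : ∀ {n} (p q : Subset n) → ∣ p ∪ q ∣ + ∣ p ∩ q ∣ ≡ ∣ p ∣ + ∣ q ∣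
∣p∪q∣+∣p∩q∣≡∣p∣+∣q∣ [] [] = refl
∣p∪q∣+∣p∩q∣≡∣p∣+∣q∣ (inside ∷ p) (inside ∷ q) = cong suc (begin
  ∣ p ∪ q ∣ + suc ∣ p ∩ q ∣   ≡⟨ +-suc ∣ p ∪ q ∣ _ ⟩
  suc (∣ p ∪ q ∣ + ∣ p ∩ q ∣) ≡⟨ cong suc (∣p∪q∣+∣p∩q∣≡∣p∣+∣q∣ p q) ⟩
  suc (∣ p ∣ + ∣ q ∣)         ≡⟨ +-suc ∣ p ∣ ∣ q ∣ ⟨
  ∣ p ∣ + suc ∣ q ∣           ∎)
  where open ≡-Reasoning
∣p∪q∣+∣p∩q∣≡∣p∣+∣q∣ (inside ∷ p) (outside ∷ q) = cong suc (∣p∪q∣+∣p∩q∣≡∣p∣+∣q∣ p q)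
∣p∪q∣+∣p∩q∣≡∣p∣+∣q∣ (outside ∷ p) (inside ∷ q) =
  trans (cong suc (∣p∪q∣+∣p∩q∣≡∣p∣+∣q∣ p q)) (sym (+-suc ∣ p ∣ ∣ q ∣))
∣p∪q∣+∣p∩q∣≡∣p∣+∣q∣ (outside ∷ p) (outside ∷ q) = ∣p∪q∣+∣p∩q∣≡∣p∣+∣q∣ p q

∣p∪q∣≤∣p∣+∣q∣ : ∀ {n} (p q : Subset n) → ∣ p ∪ q ∣ ≤ ∣ p ∣ + ∣ q ∣
∣p∪q∣≤∣p∣+∣q∣ p q = subst (∣ p ∪ q ∣ ≤_) (∣p∪q∣+∣p∩q∣≡∣p∣+∣q∣ p q) (m≤m+n _ _)

subsetOfSize : ∀ {v} (p : Subset v) (n : ℕ) → n ≤ ∣ p ∣ →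
               Σ (Subset v) (λ T → (T ⊆ p) × (∣ T ∣ ≡ n))
subsetOfSize {v} p zero _ = ⊥ , ⊥⊆ , ∣⊥∣≡0 v
subsetOfSize (outside ∷ p) (suc n) n<∣p∣ with subsetOfSize p (suc n) n<∣p∣
... | T , T⊆p , ∣T∣≡n = outside ∷ T , out⊆ T⊆p , ∣T∣≡n
subsetOfSize (inside ∷ p) (suc n) (s≤s n≤∣p∣) with subsetOfSize p n n≤∣p∣
... | T , T⊆p , ∣T∣≡n = inside ∷ T , s⊆s T⊆p , cong suc ∣T∣≡n

⋃ᶠ : ∀ {v m} → (Fin m → Subset v) → Subset v
⋃ᶠ h = ⋃ (tabulate h)

∣⋃ᶠ∣≤ : ∀ {v} m (h : Fin m → Subset v) {k} → (∀ a → ∣ h a ∣ ≤ k) → ∣ ⋃ᶠ h ∣ ≤ m * k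
∣⋃ᶠ∣≤ {v} zero h _ = ≤-reflexive (∣⊥∣≡0 v)
∣⋃ᶠ∣≤ (suc m) h h≤k =
  ≤-trans (∣p∪q∣≤∣p∣+∣q∣ (h fzero) (⋃ᶠ (h ∘ fsuc)))
          (+-mono-≤ (h≤k fzero) (∣⋃ᶠ∣≤ m (h ∘ fsuc) (h≤k ∘ fsuc)))

∣p∩⋃ᶠ∣≤ : ∀ {v} m (p : Subset v) (h : Fin m → Subset v) {c} →
          (∀ a → ∣ p ∩ h a ∣ ≤ c) → ∣ p ∩ ⋃ᶠ h ∣ ≤ m * c
∣p∩⋃ᶠ∣≤ {v} zero p h _ = ≤-reflexive (trans (cong ∣_∣ (∩-zeroʳ p)) (∣⊥∣≡0 v))
∣p∩⋃ᶠ∣≤ {v} (suc m) p h p∩h≤c = begin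
  ∣ p ∩ (h fzero ∪ U) ∣             ≡⟨ cong ∣_∣ (∩-distribˡ-∪ p (h fzero) U) ⟩
  ∣ (p ∩ h fzero) ∪ (p ∩ U) ∣       ≤⟨ ∣p∪q∣≤∣p∣+∣q∣ (p ∩ h fzero) (p ∩ U) ⟩
  ∣ p ∩ h fzero ∣ + ∣ p ∩ U ∣       ≤⟨ +-mono-≤ (p∩h≤c fzero) (∣p∩⋃ᶠ∣≤ m p (h ∘ fsuc) (p∩h≤c ∘ fsuc)) ⟩
  _ + m * _                         ∎
  where
    U = ⋃ᶠ (h ∘ fsuc)
    open ≤-Reasoning

[1+m]C2≡m+mC2 : ∀ m → suc m C 2 ≡ m + m C 2
[1+m]C2≡m+mC2 m = trans (sym (nCk+nC[k+1]≡[n+1]C[k+1] m 1)) (cong (_+ m C 2) (nC1≡n m))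

2*[1+t]C2≡[1+t]*t : ∀ t → 2 * (suc t C 2) ≡ suc t * t
2*[1+t]C2≡[1+t]*t zero = refl
2*[1+t]C2≡[1+t]*t (suc t) = begin
  2 * (suc (suc t) C 2)          ≡⟨ cong (2 *_) ([1+m]C2≡m+mC2 (suc t)) ⟩
  2 * (suc t + suc t C 2)        ≡⟨ *-distribˡ-+ 2 (suc t) _ ⟩
  2 * suc t + 2 * (suc t C 2)    ≡⟨ cong (2 * suc t +_) (2*[1+t]C2≡[1+t]*t t) ⟩
  2 * suc t + suc t * t          ≡⟨ cong (_+ suc t * t) (*-comm 2 (suc t)) ⟩
  suc t * 2 + suc t * t          ≡⟨ *-distribˡ-+ (suc t) 2 t ⟨
  suc t * suc (suc t)            ≡⟨ *-comm (suc t) (suc (suc t)) ⟩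
  suc (suc t) * suc t            ∎
  where open ≡-Reasoning

∣⋃ᶠ∣≥ : ∀ {v} m (h : Fin m → Subset v) {k c} →
        (∀ a → k ≤ ∣ h a ∣) → (∀ a b → ¬ a ≡ b → ∣ h a ∩ h b ∣ ≤ c) →
        m * k ≤ ∣ ⋃ᶠ h ∣ + c * (m C 2)
∣⋃ᶠ∣≥ zero h _ _ = z≤n
∣⋃ᶠ∣≥ (suc m) h {k} {c} k≤h h∩h≤c = begin
  k + m * k                              ≤⟨ +-mono-≤ (k≤h fzero) tail-bound ⟩
  ∣ A ∣ + (∣ U ∣ + c * (m C 2))          ≡⟨ +-assoc ∣ A ∣ ∣ U ∣ _ ⟨
  (∣ A ∣ + ∣ U ∣) + c * (m C 2)          ≡⟨ cong (_+ c * (m C 2)) (∣p∪q∣+∣p∩q∣≡∣p∣+∣q∣ A U) ⟨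
  (∣ A ∪ U ∣ + ∣ A ∩ U ∣) + c * (m C 2)  ≤⟨ +-monoˡ-≤ (c * (m C 2)) (+-monoʳ-≤ ∣ A ∪ U ∣ overlap-bound) ⟩
  (∣ A ∪ U ∣ + m * c) + c * (m C 2)      ≡⟨ +-assoc ∣ A ∪ U ∣ (m * c) _ ⟩
  ∣ A ∪ U ∣ + (m * c + c * (m C 2))      ≡⟨ cong (∣ A ∪ U ∣ +_) pairs-step ⟩
  ∣ A ∪ U ∣ + c * (suc m C 2)            ∎
  where
    open ≤-Reasoning
    A = h fzero
    U = ⋃ᶠ (h ∘ fsuc)
    tail-bound : m * k ≤ ∣ U ∣ + c * (m C 2)
    tail-bound = ∣⋃ᶠ∣≥ m (h ∘ fsuc) (k≤h ∘ fsuc) (λ a b a≢b → h∩h≤c _ _ (a≢b ∘ fsuc-injective))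
    overlap-bound : ∣ A ∩ U ∣ ≤ m * c
    overlap-bound = ∣p∩⋃ᶠ∣≤ m A (h ∘ fsuc) (λ a → h∩h≤c fzero (fsuc a) λ ())
    pairs-step : m * c + c * (m C 2) ≡ c * (suc m C 2)
    pairs-step = begin-equality
      m * c + c * (m C 2)   ≡⟨ cong (_+ c * (m C 2)) (*-comm m c) ⟩
      c * m + c * (m C 2)   ≡⟨ *-distribˡ-+ c m (m C 2) ⟨
      c * (m + m C 2)       ≡⟨ cong (c *_) ([1+m]C2≡m+mC2 m) ⟨
      c * (suc m C 2)       ∎

module Design {v k : ℕ} (S : SetSystem v) (D : Is3Design v k S) where

  -- Two distinct blocks of a 3-(v,k,1)-design share at most 2 points:
  -- a common 3-subset would lie in two different blocks.
  ∣B∩B′∣≤2 : ∀ i j → ¬ i ≡ j → ∣ block S i ∩ block S j ∣ ≤ 2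
  ∣B∩B′∣≤2 i j i≢j with 3 ≤? ∣ block S i ∩ block S j ∣
  ... | no  ∣B∩B′∣≱3 = ≤-pred (≰⇒> ∣B∩B′∣≱3)
  ... | yes ∣B∩B′∣≥3 with subsetOfSize _ 3 ∣B∩B′∣≥3
  ... | T , T⊆B∩B′ , ∣T∣≡3 with proj₂ D T ∣T∣≡3
  ... | _ , _ , unique =
    ⊥-elim (i≢j (trans (unique i (p∩q⊆p _ _ ∘ T⊆B∩B′)) (sym (unique j (p∩q⊆q _ _ ∘ T⊆B∩B′)))))

  ∣unionOf∣≤ : ∀ m (g : Fin m → Fin (b S)) → ∣ unionOf S g ∣ ≤ m * k
  ∣unionOf∣≤ m g = ∣⋃ᶠ∣≤ m (block S ∘ g) (≤-reflexive ∘ proj₁ D ∘ g)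

  ∣unionOf∣≥ : ∀ m (f : Fin m → Fin (b S)) → Injective _≡_ _≡_ f →
               m * k ≤ ∣ unionOf S f ∣ + 2 * (m C 2)
  ∣unionOf∣≥ m f f-inj =
    ∣⋃ᶠ∣≥ m (block S ∘ f) (≤-reflexive ∘ sym ∘ proj₁ D ∘ f)
           (λ a b a≢b → ∣B∩B′∣≤2 (f a) (f b) (a≢b ∘ f-inj))

corollary3p4 : (v k τ : ℕ) (S : SetSystem v) → Is3Design v k S → 1 ≤ τ →
    τ * (τ ∸ 1) + 1 ≤ k → ProducesRTS S τ
corollary3p4 v k (suc t) S D _ τ[τ-1]+1≤k = σ , 0<σ , lower , upper
  where
    open Design S D
    x σ : ℕ
    x = suc t * t
    σ = suc t * k ∸ x
    x<k : x < k
    x<k = subst (_≤ k) (+-comm x 1) τ[τ-1]+1≤k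
    0<σ : 1 ≤ σ
    0<σ = m<n⇒0<n∸m (≤-trans x<k (m≤m+n k (t * k)))
    lower : ∀ f → Injective _≡_ _≡_ f → σ ≤ ∣ unionOf S f ∣
    lower f f-inj = m≤n+o⇒m∸n≤o (suc t * k) x
      (subst (suc t * k ≤_) (trans (cong (∣ unionOf S f ∣ +_) (2*[1+t]C2≡[1+t]*t t)) (+-comm _ x))
        (∣unionOf∣≥ (suc t) f f-inj))
    tk+x<τk : t * k + x < suc t * k
    tk+x<τk = subst (t * k + x <_) (+-comm (t * k) k) (+-monoʳ-< (t * k) x<k)
    upper : ∀ g → ∣ unionOf S g ∣ < σ
    upper g = ≤-<-trans (∣unionOf∣≤ t g) (m+n≤o⇒m≤o∸n (suc (t * k)) tk+x<τk)
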